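{- Let $\mathbb{K}$ be a field of characteristic zero and let $\mathcal{R}$ be the set of polynomial sequences associated to the elements of the Riordan group, equipped with umbral composition $\sharp$: for $(p_n(x)),(q_n(x))\in\mathcal{R}$ with $p_n(x)=\sum_kp_{n,k}x^k$, $(p_n)\sharp(q_n)=(u_n)$ with $u_n(x)=\sum_{k=0}^np_{n,k}q_k(x)$. Let $h=\sum_{n\ge0}h_nx^n\in\mathbb{K}[[x]]$ with $h_n\neq0$ for all $n$ (a Hadamard unit), and let $\mathcal{R}_h=\{(p_n(x)\star h(x))_{n\in\mathbb{N}} : (p_n(x))\in\mathcal{R}\}$. Then the map $H_h:\mathcal{R}\to\mathcal{R}_h$, $(p_n(x))\mapsto(p_n(x)\star h(x))$ is bijective; consequently, defining $\sharp_h$ on $\mathcal{R}_h$ by $S\sharp_hT=H_h\big(H_h^{ -1}(S)\sharp H_h^{ -1}(T)\big)$, $(\mathcal{R}_h,\sharp_h)$ is a group and $H_h$ is a group isomorphism. Moreover, if $(s_n(x)),(t_n(x))\in\mathcal{R}_h$ with $s_n(x)=\sum_{k=0}^ns_{n,k}x^k$, $t_n(x)=\sum_{k=0}^nt_{n,k}x^k$ and $(r_n(x))=(s_n(x))\sharp_h(t_n(x))$ with $r_n(x)=\sum_{k=0}^nr_{n,k}x^k$, then \[ r_{n,j}=\sum_{k=j}^n\frac{1}{h_k}s_{n,k}t_{k,j}. \]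
   Context: For $f,g\in\mathbb{K}[[x]]$ with $g(0)\neq0$, $T(f\mid g)$ is the infinite lower triangular matrix whose $k$-th column has generating function $\frac{f(x)}{g(x)}\left(\frac{x}{g(x)}\right)^k$; the Riordan group is the set of such matrices with $f(0)\neq0$, $g(0)\neq0$ under matrix multiplication. The associated polynomial sequence of $(a_{n,j})$ is $p_n(x)=\sum_{j=0}^n a_{n,j}x^j$, and $(\mathcal{R},\sharp)$ is a group isomorphic to the Riordan group. $\star$ is the Hadamard product $\left(\sum a_nx^n\right)\star\left(\sum b_nx^n\right)=\sum a_nb_nx^n$. -}

module Defs where

open import Level using (Level; _⊔_) renaming (suc to lsuc)
open import Data.Nat using (ℕ; zero; suc; _∸_; _≤_) renaming (_+_ to _+ℕ_)
open import Data.Product using (Σ; ∃; _×_; _,_)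
open import Relation.Nullary using (¬_)
open import Algebra.Bundles using (CommutativeRing)

-- A field: a commutative ring with 0 ≠ 1 in which every nonzero element
-- has a multiplicative inverse (the inverse is given as a total function,
-- whose value at 0 is irrelevant).
record Field (c ℓ : Level) : Set (lsuc (c ⊔ ℓ)) where
  field
    commutativeRing : CommutativeRing c ℓ
  open CommutativeRing commutativeRing public
  field
    inv   : Carrier → Carrier
    inv-r : ∀ x → ¬ (x ≈ 0#) → x * inv x ≈ 1#
    0≉1   : ¬ (0# ≈ 1#)

module Riordan {c ℓ : Level} (F : Field c ℓ) where
  open Field F

  fromℕ : ℕ → Carrier
  fromℕ zero    = 0#
  fromℕ (suc n) = 1# + fromℕ n

  CharZero : Set ℓ
  CharZero = ∀ n → ¬ (fromℕ (suc n) ≈ 0#)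

  Σ≤ : ℕ → (ℕ → Carrier) → Carrier
  Σ≤ zero    f = f 0
  Σ≤ (suc n) f = Σ≤ n f + f (suc n)

  -- Σ_{k=j}^{n} f k   (intended for j ≤ n)
  ΣFromTo : ℕ → ℕ → (ℕ → Carrier) → Carrier
  ΣFromTo j n f = Σ≤ (n ∸ j) (λ i → f (j +ℕ i))

  Series : Set c
  Series = ℕ → Carrier

  _≈ₛ_ : Series → Series → Set ℓ
  a ≈ₛ b = ∀ n → a n ≈ b n

  _·ₛ_ : Series → Series → Series
  (a ·ₛ b) n = Σ≤ n (λ i → a i * b (n ∸ i))

  oneₛ : Series
  oneₛ zero    = 1#
  oneₛ (suc n) = 0#

  _^ₛ_ : Series → ℕ → Series
  a ^ₛ zero  = oneₛ
  a ^ₛ suc k = a ·ₛ (a ^ₛ k)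

  shift : Series → Series
  shift a zero    = 0#
  shift a (suc n) = a n

  shiftBy : ℕ → Series → Series
  shiftBy zero    a = a
  shiftBy (suc k) a = shift (shiftBy k a)

  -- A polynomial sequence (p_n(x))_n with p_n(x) = Σ_{j=0}^{n} p_{n,j} x^j is
  -- represented by its coefficient array (n , j) ↦ p_{n,j}.
  PolySeq : Set c
  PolySeq = ℕ → ℕ → Carrier

  _≈P_ : PolySeq → PolySeq → Set ℓ
  P ≈P Q = ∀ n j → P n j ≈ Q n j

  column : PolySeq → ℕ → Series
  column A k n = A n k

  -- A is the Riordan array T(f | g): f(0) ≠ 0, g(0) ≠ 0 and the k-th column
  -- has generating function (f/g)(x/g)^k = x^k f / g^(k+1), i.e.
  -- (column k) · g^(k+1) = x^k f  (g is invertible in K[[x]]).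
  IsT : Series → Series → PolySeq → Set ℓ
  IsT f g A = ∀ k → (column A k ·ₛ (g ^ₛ suc k)) ≈ₛ shiftBy k f

  Inℛ : PolySeq → Set (c ⊔ ℓ)
  Inℛ A = Σ Series λ f → Σ Series λ g →
            ¬ (f 0 ≈ 0#) × ¬ (g 0 ≈ 0#) × IsT f g A

  _♯_ : PolySeq → PolySeq → PolySeq
  (P ♯ Q) n j = Σ≤ n (λ k → P n k * Q k j)

  Hh : Series → PolySeq → PolySeq
  Hh h P n k = P n k * h k

  Inℛh : Series → PolySeq → Set (c ⊔ ℓ)
  Inℛh h S = Σ PolySeq λ P → Inℛ P × (Hh h P ≈P S)

  Hh⁻¹ : Series → PolySeq → PolySeq
  Hh⁻¹ h S n k = S n k * inv (h k)

  ♯[_] : Series → PolySeq → PolySeq → PolySeq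
  ♯[ h ] S T = Hh h (Hh⁻¹ h S ♯ Hh⁻¹ h T)

  record IsGroupOn (U : PolySeq → Set (c ⊔ ℓ))
                   (_∙_ : PolySeq → PolySeq → PolySeq) : Set (c ⊔ ℓ) where
    field
      ∙-cong  : ∀ {A A′ B B′} → A ≈P A′ → B ≈P B′ → (A ∙ B) ≈P (A′ ∙ B′)
      closed  : ∀ {A B} → U A → U B → U (A ∙ B)
      assoc   : ∀ {A B C} → U A → U B → U C → ((A ∙ B) ∙ C) ≈P (A ∙ (B ∙ C))
      e        : PolySeq
      e∈U      : U e
      identityˡ : ∀ {A} → U A → (e ∙ A) ≈P A
      identityʳ : ∀ {A} → U A → (A ∙ e) ≈P A
      inverse  : ∀ {A} → U A →
                   Σ PolySeq λ B → U B × ((A ∙ B) ≈P e) × ((B ∙ A) ≈P e)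

-- Everything about H_h is coordinatewise bookkeeping: H_h and H_h⁻¹ scale the
-- k-th coefficient of every row by h_k and by 1/h_k, so they are mutually
-- inverse, ♯_h is ♯ transported along them, and the coefficient formula is a
-- rearrangement of Σ_k (s_{n,k}/h_k)(t_{k,j}/h_j) h_j.  The real content is
-- that (ℛ, ♯) is a group, proved here without series composition:
--
--  * finite sums, then power series as a commutative monoid under the Cauchy
--    product, with truncation to degree n;
--  * arrays act on series by (A·u)_n = Σ_k A_{n,k} u_k, and on lower
--    triangular arrays ♯ is composition of these actions;
--  * forward substitution inverts arrays with nonzero diagonal, and hence
--    series with nonzero constant term;
--  * A ∈ ℛ iff its columns are x^k d s^k with d(0), s(0) ≠ 0, iff A is lower
--    triangular with nonzero diagonal and A(u w) · A(1) = A(u) · A(w); this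
--    last class is visibly closed under ♯ and under inversion.
module Submission where

open import Defs
open import Level using (Level; _⊔_)
open import Data.Nat using (ℕ; zero; suc; _≤_; _<_; _∸_; z≤n; s≤s)
  renaming (_+_ to _+ℕ_)
open import Data.Nat.Properties
  using (_≟_; _≤?_; ≰⇒>; <-trans; ≤-pred; ≤∧≢⇒<; m≤n⇒m≤1+n; ≤-refl; ≤-trans;
         m≤n+m; m∸n+n≡m; m∸[m∸n]≡n; m+[n∸m]≡n; m≤n⇒m<n∨m≡n; <⇒≢; m∸n≤m;
         ∸-+-assoc; m+n∸m≡n; +-∸-assoc; n∸n≡0; +-suc; ≤-<-trans)
  renaming (+-identityʳ to +ℕ-identityʳ)
open import Data.Product using (Σ; _×_; _,_; proj₁)
open import Data.Sum using (inj₁; inj₂)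
open import Data.Empty using (⊥-elim)
open import Data.Nat.Induction using (<-rec)
open import Relation.Nullary using (¬_; yes; no; Dec)
open import Relation.Binary.PropositionalEquality as ≡ using (_≡_)
open import Relation.Binary.Bundles using (Setoid)
import Relation.Binary.Reasoning.Setoid as SetoidReasoning
open import Algebra.Bundles using (CommutativeMonoid)
import Algebra.Solver.CommutativeMonoid as CMSolver

module RiordanTheory {c ℓ : Level} (F : Field c ℓ) where
  open Field F hiding (zero)
  open Riordan F
  module ≈-Reasoning = SetoidReasoning setoid
  open import Algebra.Properties.CommutativeSemigroup +-commutativeSemigroup
    using () renaming (interchange to +-interchange)
  open import Algebra.Properties.CommutativeSemigroup *-commutativeSemigroup
    using () renaming (x∙yz≈y∙xz to *-swap-left)

  +-cancel-neg : ∀ a b → a + (b + - a) ≈ b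
  +-cancel-neg a b = begin
    a + (b + - a)    ≈⟨ +-cong refl (+-comm b (- a)) ⟩
    a + (- a + b)    ≈⟨ sym (+-assoc a (- a) b) ⟩
    (a + - a) + b    ≈⟨ +-cong (-‿inverseʳ a) refl ⟩
    0# + b           ≈⟨ +-identityˡ b ⟩
    b                ∎
    where open ≈-Reasoning

  1≉0 : ¬ (1# ≈ 0#)
  1≉0 e = 0≉1 (sym e)

  inv-l : ∀ a → ¬ (a ≈ 0#) → inv a * a ≈ 1#
  inv-l a a≉0 = trans (*-comm (inv a) a) (inv-r a a≉0)

  *-nonzero : ∀ {a b} → ¬ (a ≈ 0#) → ¬ (b ≈ 0#) → ¬ (a * b ≈ 0#)
  *-nonzero {a} {b} a≉0 b≉0 ab≈0 = a≉0 (begin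
    a                 ≈⟨ sym (*-identityʳ a) ⟩
    a * 1#            ≈⟨ *-cong refl (sym (inv-r b b≉0)) ⟩
    a * (b * inv b)   ≈⟨ sym (*-assoc a b (inv b)) ⟩
    (a * b) * inv b   ≈⟨ *-cong ab≈0 refl ⟩
    0# * inv b        ≈⟨ zeroˡ (inv b) ⟩
    0#                ∎)
    where open ≈-Reasoning

  unit-nonzero : ∀ {a b} → a * b ≈ 1# → ¬ (a ≈ 0#)
  unit-nonzero {a} {b} ab≈1 a≈0 =
    0≉1 (trans (sym (zeroˡ b)) (trans (*-cong (sym a≈0) refl) ab≈1))

  Σ-cong : ∀ n {f g : ℕ → Carrier} → (∀ i → i ≤ n → f i ≈ g i) → Σ≤ n f ≈ Σ≤ n g
  Σ-cong zero    f≈g = f≈g 0 z≤n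
  Σ-cong (suc n) f≈g =
    +-cong (Σ-cong n (λ i i≤n → f≈g i (m≤n⇒m≤1+n i≤n))) (f≈g (suc n) ≤-refl)

  Σ-cong′ : ∀ n {f g : ℕ → Carrier} → (∀ i → f i ≈ g i) → Σ≤ n f ≈ Σ≤ n g
  Σ-cong′ n f≈g = Σ-cong n (λ i _ → f≈g i)

  Σ-zero : ∀ n (f : ℕ → Carrier) → (∀ i → i ≤ n → f i ≈ 0#) → Σ≤ n f ≈ 0#
  Σ-zero n f f≈0 = trans (Σ-cong n f≈0) (zeros n)
    where
    zeros : ∀ n → Σ≤ n (λ _ → 0#) ≈ 0#
    zeros zero    = refl
    zeros (suc n) = trans (+-identityʳ _) (zeros n)

  Σ-+ : ∀ n (f g : ℕ → Carrier) → Σ≤ n (λ i → f i + g i) ≈ Σ≤ n f + Σ≤ n g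
  Σ-+ zero    f g = refl
  Σ-+ (suc n) f g = trans (+-cong (Σ-+ n f g) refl) (+-interchange _ _ _ _)

  Σ-*ˡ : ∀ n a (f : ℕ → Carrier) → a * Σ≤ n f ≈ Σ≤ n (λ i → a * f i)
  Σ-*ˡ zero    a f = refl
  Σ-*ˡ (suc n) a f = trans (distribˡ a _ _) (+-cong (Σ-*ˡ n a f) refl)

  Σ-*ʳ : ∀ n a (f : ℕ → Carrier) → Σ≤ n f * a ≈ Σ≤ n (λ i → f i * a)
  Σ-*ʳ zero    a f = refl
  Σ-*ʳ (suc n) a f = trans (distribʳ a _ _) (+-cong (Σ-*ʳ n a f) refl)

  Σ-swap : ∀ n m (G : ℕ → ℕ → Carrier) →
           Σ≤ n (λ i → Σ≤ m (G i)) ≈ Σ≤ m (λ j → Σ≤ n (λ i → G i j))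
  Σ-swap zero    m G = refl
  Σ-swap (suc n) m G = trans (+-cong (Σ-swap n m G) refl) (sym (Σ-+ m _ _))

  Σ-peel : ∀ n (f : ℕ → Carrier) → Σ≤ (suc n) f ≈ f 0 + Σ≤ n (λ i → f (suc i))
  Σ-peel zero    f = refl
  Σ-peel (suc n) f = trans (+-cong (Σ-peel n f) refl) (+-assoc _ _ _)

  Σ-reverse : ∀ n (f : ℕ → Carrier) → Σ≤ n f ≈ Σ≤ n (λ i → f (n ∸ i))
  Σ-reverse zero    f = refl
  Σ-reverse (suc n) f = trans (+-cong (Σ-reverse n f) refl)
    (trans (+-comm _ _) (sym (Σ-peel n (λ i → f (suc n ∸ i)))))

  Σ-extend : ∀ {n m} (f : ℕ → Carrier) → n ≤ m → (∀ i → n < i → f i ≈ 0#) →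
             Σ≤ m f ≈ Σ≤ n f
  Σ-extend {n} {m} f n≤m f≈0 =
    ≡.subst (λ x → Σ≤ x f ≈ Σ≤ n f) (m∸n+n≡m n≤m) (go (m ∸ n))
    where
    go : ∀ k → Σ≤ (k +ℕ n) f ≈ Σ≤ n f
    go zero    = refl
    go (suc k) = trans (+-cong (go k) (f≈0 (suc (k +ℕ n)) (s≤s (m≤n+m n k))))
                       (+-identityʳ _)

  Σ-skip : ∀ j m (f : ℕ → Carrier) → (∀ i → i < j → f i ≈ 0#) →
           Σ≤ (j +ℕ m) f ≈ Σ≤ m (λ i → f (j +ℕ i))
  Σ-skip zero    m f f≈0 = refl
  Σ-skip (suc j) m f f≈0 = begin
    Σ≤ (suc (j +ℕ m)) f
      ≈⟨ Σ-peel (j +ℕ m) f ⟩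
    f 0 + Σ≤ (j +ℕ m) (λ i → f (suc i))
      ≈⟨ +-cong (f≈0 0 (s≤s z≤n)) (Σ-skip j m (λ i → f (suc i)) (λ i i<j → f≈0 (suc i) (s≤s i<j))) ⟩
    0# + Σ≤ m (λ i → f (suc (j +ℕ i)))
      ≈⟨ +-identityˡ _ ⟩
    Σ≤ m (λ i → f (suc j +ℕ i)) ∎
    where open ≈-Reasoning

  Σ-triangle : ∀ n (G : ℕ → ℕ → Carrier) →
               Σ≤ n (λ i → Σ≤ i (G i)) ≈ Σ≤ n (λ j → Σ≤ (n ∸ j) (λ l → G (j +ℕ l) j))
  Σ-triangle zero    G = refl
  Σ-triangle (suc n) G = begin
    Σ≤ n (λ i → Σ≤ i (G i)) + (Σ≤ n (G (suc n)) + G (suc n) (suc n))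
      ≈⟨ +-cong (Σ-triangle n G) refl ⟩
    Σ≤ n (λ j → Σ≤ (n ∸ j) (λ l → G (j +ℕ l) j)) + (Σ≤ n (G (suc n)) + G (suc n) (suc n))
      ≈⟨ sym (+-assoc _ _ _) ⟩
    (Σ≤ n (λ j → Σ≤ (n ∸ j) (λ l → G (j +ℕ l) j)) + Σ≤ n (G (suc n))) + G (suc n) (suc n)
      ≈⟨ +-cong (sym (Σ-+ n _ _)) diagonal ⟩
    Σ≤ n (λ j → Σ≤ (n ∸ j) (λ l → G (j +ℕ l) j) + G (suc n) j)
      + Σ≤ (suc n ∸ suc n) (λ l → G (suc n +ℕ l) (suc n))
      ≈⟨ +-cong (Σ-cong n extend-column) refl ⟩
    Σ≤ n (λ j → Σ≤ (suc n ∸ j) (λ l → G (j +ℕ l) j))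
      + Σ≤ (suc n ∸ suc n) (λ l → G (suc n +ℕ l) (suc n)) ∎
    where
    open ≈-Reasoning
    diagonal : G (suc n) (suc n) ≈ Σ≤ (suc n ∸ suc n) (λ l → G (suc n +ℕ l) (suc n))
    diagonal rewrite n∸n≡0 n | +ℕ-identityʳ n = refl
    extend-column : ∀ j → j ≤ n → Σ≤ (n ∸ j) (λ l → G (j +ℕ l) j) + G (suc n) j
                           ≈ Σ≤ (suc n ∸ j) (λ l → G (j +ℕ l) j)
    extend-column j j≤n rewrite +-∸-assoc 1 j≤n =
      +-cong refl (reflexive (≡.cong (λ x → G x j)
        (≡.trans (≡.cong suc (≡.sym (m+[n∸m]≡n j≤n))) (≡.sym (+-suc j (n ∸ j))))))

  Σ< : ℕ → (ℕ → Carrier) → Carrier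
  Σ< zero    f = 0#
  Σ< (suc n) f = Σ≤ n f

  Σ-last : ∀ n (f : ℕ → Carrier) → Σ≤ n f ≈ Σ< n f + f n
  Σ-last zero    f = sym (+-identityˡ _)
  Σ-last (suc n) f = refl

  Σ<-cong : ∀ n {f g : ℕ → Carrier} → (∀ i → i < n → f i ≈ g i) → Σ< n f ≈ Σ< n g
  Σ<-cong zero    f≈g = refl
  Σ<-cong (suc n) f≈g = Σ-cong n (λ i i≤n → f≈g i (s≤s i≤n))

  Σ<-zero : ∀ n (f : ℕ → Carrier) → (∀ i → i < n → f i ≈ 0#) → Σ< n f ≈ 0#
  Σ<-zero zero    f f≈0 = refl
  Σ<-zero (suc n) f f≈0 = Σ-zero n f (λ i i≤n → f≈0 i (s≤s i≤n))

  Σ-only-last : ∀ n (f : ℕ → Carrier) → (∀ i → i < n → f i ≈ 0#) → Σ≤ n f ≈ f n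
  Σ-only-last n f f≈0 =
    trans (Σ-last n f) (trans (+-cong (Σ<-zero n f f≈0) refl) (+-identityˡ _))

  δ : ℕ → ℕ → Carrier
  δ zero    zero    = 1#
  δ zero    (suc k) = 0#
  δ (suc i) zero    = 0#
  δ (suc i) (suc k) = δ i k

  δ-diag : ∀ i → δ i i ≡ 1#
  δ-diag zero    = ≡.refl
  δ-diag (suc i) = δ-diag i

  δ-off : ∀ i k → ¬ (i ≡ k) → δ i k ≡ 0#
  δ-off zero    zero    i≢k = ⊥-elim (i≢k ≡.refl)
  δ-off zero    (suc k) i≢k = ≡.refl
  δ-off (suc i) zero    i≢k = ≡.refl
  δ-off (suc i) (suc k) i≢k = δ-off i k (λ i≡k → i≢k (≡.cong suc i≡k))

  δ-sym : ∀ i k → δ i k ≡ δ k i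
  δ-sym zero    zero    = ≡.refl
  δ-sym zero    (suc k) = ≡.refl
  δ-sym (suc i) zero    = ≡.refl
  δ-sym (suc i) (suc k) = δ-sym i k

  δ-off-* : ∀ {i k} y → ¬ (i ≡ k) → δ i k * y ≈ 0#
  δ-off-* {i} {k} y i≢k = trans (*-cong (reflexive (δ-off i k i≢k)) refl) (zeroˡ y)

  Σ-δ-out : ∀ n k (f : ℕ → Carrier) → n < k → Σ≤ n (λ i → δ i k * f i) ≈ 0#
  Σ-δ-out n k f n<k = Σ-zero n _ (λ i i≤n → δ-off-* (f i) (<⇒≢ (≤-<-trans i≤n n<k)))

  Σ-δ-in : ∀ n k (f : ℕ → Carrier) → k ≤ n → Σ≤ n (λ i → δ i k * f i) ≈ f k
  Σ-δ-in zero .zero f z≤n = *-identityˡ (f 0)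
  Σ-δ-in (suc n) k f k≤1+n with m≤n⇒m<n∨m≡n k≤1+n
  ... | inj₁ (s≤s k≤n) = trans (+-cong (Σ-δ-in n k f k≤n)
                                  (δ-off-* (f (suc n)) (λ e → <⇒≢ (s≤s k≤n) (≡.sym e))))
                               (+-identityʳ _)
  ... | inj₂ ≡.refl    = trans (+-cong (Σ-δ-out n (suc n) f ≤-refl)
                                  (trans (*-cong (reflexive (δ-diag (suc n))) refl) (*-identityˡ _)))
                               (+-identityˡ _)

  seriesSetoid : Setoid c ℓ
  seriesSetoid = record
    { Carrier       = Series
    ; _≈_           = _≈ₛ_
    ; isEquivalence = record
      { refl  = λ n → refl
      ; sym   = λ a≈b n → sym (a≈b n)
      ; trans = λ a≈b b≈d n → trans (a≈b n) (b≈d n) } }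

  open Setoid seriesSetoid
    using () renaming (refl to reflₛ; sym to symₛ; trans to transₛ)
  module SeriesReasoning = SetoidReasoning seriesSetoid

  ·-cong : ∀ {a a′ b b′} → a ≈ₛ a′ → b ≈ₛ b′ → (a ·ₛ b) ≈ₛ (a′ ·ₛ b′)
  ·-cong a≈a′ b≈b′ n = Σ-cong′ n (λ i → *-cong (a≈a′ i) (b≈b′ (n ∸ i)))

  ·-comm : ∀ a b → (a ·ₛ b) ≈ₛ (b ·ₛ a)
  ·-comm a b n = trans (Σ-reverse n _) (Σ-cong n (λ i i≤n →
    trans (*-cong refl (reflexive (≡.cong b (m∸[m∸n]≡n i≤n)))) (*-comm _ _)))

  oneₛ≡δ : ∀ i → oneₛ i ≡ δ i 0
  oneₛ≡δ zero    = ≡.refl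
  oneₛ≡δ (suc i) = ≡.refl

  ·-identityˡ : ∀ a → (oneₛ ·ₛ a) ≈ₛ a
  ·-identityˡ a n = trans (Σ-cong′ n (λ i → *-cong (reflexive (oneₛ≡δ i)) refl))
                          (Σ-δ-in n 0 (λ i → a (n ∸ i)) z≤n)

  ·-identityʳ : ∀ a → (a ·ₛ oneₛ) ≈ₛ a
  ·-identityʳ a = transₛ (·-comm a oneₛ) (·-identityˡ a)

  ·-assoc : ∀ a b d → ((a ·ₛ b) ·ₛ d) ≈ₛ (a ·ₛ (b ·ₛ d))
  ·-assoc a b d n = begin
    Σ≤ n (λ i → Σ≤ i (λ j → a j * b (i ∸ j)) * d (n ∸ i))
      ≈⟨ Σ-cong′ n (λ i → Σ-*ʳ i _ _) ⟩
    Σ≤ n (λ i → Σ≤ i (λ j → (a j * b (i ∸ j)) * d (n ∸ i)))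
      ≈⟨ Σ-triangle n (λ i j → (a j * b (i ∸ j)) * d (n ∸ i)) ⟩
    Σ≤ n (λ j → Σ≤ (n ∸ j) (λ l → (a j * b ((j +ℕ l) ∸ j)) * d (n ∸ (j +ℕ l))))
      ≈⟨ Σ-cong′ n (λ j → Σ-cong′ (n ∸ j) (λ l → trans (*-assoc _ _ _)
           (*-cong refl (*-cong (reflexive (≡.cong b (m+n∸m≡n j l)))
                                (reflexive (≡.cong d (≡.sym (∸-+-assoc n j l)))))))) ⟩
    Σ≤ n (λ j → Σ≤ (n ∸ j) (λ l → a j * (b l * d ((n ∸ j) ∸ l))))
      ≈⟨ Σ-cong′ n (λ j → sym (Σ-*ˡ (n ∸ j) (a j) _)) ⟩
    Σ≤ n (λ j → a j * Σ≤ (n ∸ j) (λ l → b l * d ((n ∸ j) ∸ l))) ∎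
    where open ≈-Reasoning

  ·-commutativeMonoid : CommutativeMonoid c ℓ
  ·-commutativeMonoid = record
    { Carrier = Series ; _≈_ = _≈ₛ_ ; _∙_ = _·ₛ_ ; ε = oneₛ
    ; isCommutativeMonoid = record
      { isMonoid = record
        { isSemigroup = record
          { isMagma = record
            { isEquivalence = Setoid.isEquivalence seriesSetoid
            ; ∙-cong = λ {a} {a′} {b} {b′} → ·-cong {a} {a′} {b} {b′} }
          ; assoc = ·-assoc }
        ; identity = ·-identityˡ , ·-identityʳ }
      ; comm = ·-comm } }

  module ·-Solver = CMSolver ·-commutativeMonoid

  ^-cong : ∀ {a b} k → a ≈ₛ b → (a ^ₛ k) ≈ₛ (b ^ₛ k)
  ^-cong zero    a≈b = reflₛ
  ^-cong (suc k) a≈b = ·-cong a≈b (^-cong k a≈b)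

  ^-+ : ∀ a j k → (a ^ₛ (j +ℕ k)) ≈ₛ ((a ^ₛ j) ·ₛ (a ^ₛ k))
  ^-+ a zero    k = symₛ (·-identityˡ _)
  ^-+ a (suc j) k = transₛ (·-cong (reflₛ {a}) (^-+ a j k)) (symₛ (·-assoc a (a ^ₛ j) (a ^ₛ k)))

  ^-· : ∀ a b k → ((a ·ₛ b) ^ₛ k) ≈ₛ ((a ^ₛ k) ·ₛ (b ^ₛ k))
  ^-· a b zero    = symₛ (·-identityˡ oneₛ)
  ^-· a b (suc k) = transₛ (·-cong (reflₛ {a ·ₛ b}) (^-· a b k))
    (solve 4 (λ a b p q → (a ⊕ b) ⊕ (p ⊕ q) ⊜ (a ⊕ p) ⊕ (b ⊕ q)) reflₛ a b (a ^ₛ k) (b ^ₛ k))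
    where open ·-Solver

  one-^ : ∀ k → (oneₛ ^ₛ k) ≈ₛ oneₛ
  one-^ zero    = reflₛ
  one-^ (suc k) = transₛ (·-identityˡ _) (one-^ k)

  -- The constant term is multiplicative, so powers of units have unit constant term.
  ^-constant-nonzero : ∀ a k → ¬ (a 0 ≈ 0#) → ¬ ((a ^ₛ k) 0 ≈ 0#)
  ^-constant-nonzero a zero    a0≉0 = 1≉0
  ^-constant-nonzero a (suc k) a0≉0 = *-nonzero a0≉0 (^-constant-nonzero a k a0≉0)

  _⋆_ : Carrier → Series → Series
  (k ⋆ a) n = k * a n

  ΣS : ℕ → (ℕ → Series) → Series
  ΣS m G n = Σ≤ m (λ i → G i n)

  ΣS-cong : ∀ m {G H : ℕ → Series} → (∀ i → G i ≈ₛ H i) → ΣS m G ≈ₛ ΣS m H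
  ΣS-cong m G≈H n = Σ-cong′ m (λ i → G≈H i n)

  ⋆-cong : ∀ {k k′ a b} → k ≈ k′ → a ≈ₛ b → (k ⋆ a) ≈ₛ (k′ ⋆ b)
  ⋆-cong k≈k′ a≈b n = *-cong k≈k′ (a≈b n)

  ⋆-· : ∀ k a b → ((k ⋆ a) ·ₛ b) ≈ₛ (k ⋆ (a ·ₛ b))
  ⋆-· k a b n = trans (Σ-cong′ n (λ i → *-assoc k (a i) _)) (sym (Σ-*ˡ n k _))

  ⋆-·-⋆ : ∀ k k′ a b → ((k ⋆ a) ·ₛ (k′ ⋆ b)) ≈ₛ ((k * k′) ⋆ (a ·ₛ b))
  ⋆-·-⋆ k k′ a b n = begin
    ((k ⋆ a) ·ₛ (k′ ⋆ b)) n   ≈⟨ ⋆-· k a (k′ ⋆ b) n ⟩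
    k * (a ·ₛ (k′ ⋆ b)) n     ≈⟨ *-cong refl (·-comm a (k′ ⋆ b) n) ⟩
    k * ((k′ ⋆ b) ·ₛ a) n     ≈⟨ *-cong refl (⋆-· k′ b a n) ⟩
    k * (k′ * (b ·ₛ a) n)     ≈⟨ sym (*-assoc k k′ _) ⟩
    (k * k′) * (b ·ₛ a) n     ≈⟨ *-cong refl (·-comm b a n) ⟩
    (k * k′) * (a ·ₛ b) n     ∎
    where open ≈-Reasoning

  ΣS-· : ∀ m (G : ℕ → Series) b → (ΣS m G ·ₛ b) ≈ₛ ΣS m (λ i → G i ·ₛ b)
  ΣS-· m G b n = trans (Σ-cong′ n (λ l → Σ-*ʳ m _ _)) (Σ-swap n m _)

  ΣS-·-ΣS : ∀ n (a b : ℕ → Carrier) (P Q : ℕ → Series) →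
    (ΣS n (λ i → a i ⋆ P i) ·ₛ ΣS n (λ j → b j ⋆ Q j))
      ≈ₛ ΣS n (λ i → ΣS n (λ j → (a i * b j) ⋆ (P i ·ₛ Q j)))
  ΣS-·-ΣS n a b P Q =
    transₛ (ΣS-· n (λ i → a i ⋆ P i) Q′) (ΣS-cong n (λ i →
    transₛ (·-comm (a i ⋆ P i) Q′) (transₛ (ΣS-· n (λ j → b j ⋆ Q j) (a i ⋆ P i)) (ΣS-cong n (λ j →
    transₛ (·-comm (b j ⋆ Q j) (a i ⋆ P i)) (⋆-·-⋆ (a i) (b j) (P i) (Q j)))))))
    where
    Q′ : Series
    Q′ = ΣS n (λ j → b j ⋆ Q j)

  X : Series
  X = shift oneₛ

  shift-cong : ∀ {a b} → a ≈ₛ b → shift a ≈ₛ shift b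
  shift-cong a≈b zero    = refl
  shift-cong a≈b (suc n) = a≈b n

  X-· : ∀ a → (X ·ₛ a) ≈ₛ shift a
  X-· a zero    = zeroˡ _
  X-· a (suc n) = trans (Σ-peel n _) (trans (+-cong (zeroˡ _) (·-identityˡ a n)) (+-identityˡ _))

  X^-coefficient : ∀ k n → (X ^ₛ k) n ≈ δ n k
  X^-coefficient zero    n       = reflexive (oneₛ≡δ n)
  X^-coefficient (suc k) n       = trans (X-· (X ^ₛ k) n) (shifted n)
    where
    shifted : ∀ n → shift (X ^ₛ k) n ≈ δ n (suc k)
    shifted zero    = refl
    shifted (suc n) = X^-coefficient k n

  shiftBy≈X^· : ∀ k a → shiftBy k a ≈ₛ ((X ^ₛ k) ·ₛ a)
  shiftBy≈X^· zero    a = symₛ (·-identityˡ a)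
  shiftBy≈X^· (suc k) a = transₛ (shift-cong (shiftBy≈X^· k a))
    (transₛ (symₛ (X-· _)) (symₛ (·-assoc X _ a)))

  shiftBy-below : ∀ k a n → n < k → shiftBy k a n ≡ 0#
  shiftBy-below (suc k) a zero    n<k       = ≡.refl
  shiftBy-below (suc k) a (suc n) (s≤s n<k) = shiftBy-below k a n n<k

  shiftBy-at : ∀ k a → shiftBy k a k ≡ a 0
  shiftBy-at zero    a = ≡.refl
  shiftBy-at (suc k) a = shiftBy-at k a

  Agree : ℕ → Series → Series → Set ℓ
  Agree n a b = ∀ m → m ≤ n → a m ≈ b m

  ≈⇒Agree : ∀ {n a b} → a ≈ₛ b → Agree n a b
  ≈⇒Agree a≈b m _ = a≈b m

  Agree-sym : ∀ {n a b} → Agree n a b → Agree n b a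
  Agree-sym a≈b m m≤n = sym (a≈b m m≤n)

  Agree-trans : ∀ {n a b d} → Agree n a b → Agree n b d → Agree n a d
  Agree-trans a≈b b≈d m m≤n = trans (a≈b m m≤n) (b≈d m m≤n)

  ·-Agree : ∀ {n a a′ b b′} → Agree n a a′ → Agree n b b′ → Agree n (a ·ₛ b) (a′ ·ₛ b′)
  ·-Agree a≈a′ b≈b′ m m≤n = Σ-cong m (λ i i≤m →
    *-cong (a≈a′ i (≤-trans i≤m m≤n)) (b≈b′ (m ∸ i) (≤-trans (m∸n≤m m i) m≤n)))

  truncation : ∀ n u → Agree n u (ΣS n (λ i → u i ⋆ (X ^ₛ i)))
  truncation n u m m≤n = sym (begin
    Σ≤ n (λ i → u i * (X ^ₛ i) m) ≈⟨ Σ-cong′ n (λ i → *-cong refl (X^-coefficient i m)) ⟩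
    Σ≤ n (λ i → u i * δ m i)      ≈⟨ Σ-cong′ n (λ i → trans (*-comm _ _) (*-cong (reflexive (δ-sym m i)) refl)) ⟩
    Σ≤ n (λ i → δ i m * u i)      ≈⟨ Σ-δ-in n m u m≤n ⟩
    u m                           ∎)
    where open ≈-Reasoning

  reflP : ∀ {A} → A ≈P A
  reflP n j = refl

  symP : ∀ {A B} → A ≈P B → B ≈P A
  symP A≈B n k = sym (A≈B n k)

  transP : ∀ {A B C} → A ≈P B → B ≈P C → A ≈P C
  transP A≈B B≈C n k = trans (A≈B n k) (B≈C n k)

  Lower : PolySeq → Set ℓ
  Lower A = ∀ n k → n < k → A n k ≈ 0#

  Id : PolySeq
  Id = δ

  apply : PolySeq → Series → Series
  apply A u n = Σ≤ n (λ k → A n k * u k)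

  apply-cong : ∀ {A A′ u u′} → A ≈P A′ → u ≈ₛ u′ → apply A u ≈ₛ apply A′ u′
  apply-cong A≈A′ u≈u′ n = Σ-cong′ n (λ k → *-cong (A≈A′ n k) (u≈u′ k))

  apply-Agree : ∀ A {n u u′} → Agree n u u′ → Agree n (apply A u) (apply A u′)
  apply-Agree A u≈u′ m m≤n = Σ-cong m (λ k k≤m → *-cong refl (u≈u′ k (≤-trans k≤m m≤n)))

  apply-ΣS : ∀ A m (G : ℕ → Series) → apply A (ΣS m G) ≈ₛ ΣS m (λ i → apply A (G i))
  apply-ΣS A m G n =
    trans (Σ-cong′ n (λ j → Σ-*ˡ m (A n j) _)) (Σ-swap n m _)

  apply-⋆ : ∀ A k u → apply A (k ⋆ u) ≈ₛ (k ⋆ apply A u)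
  apply-⋆ A k u n = trans (Σ-cong′ n (λ j → *-swap-left (A n j) k (u j))) (sym (Σ-*ˡ n k _))

  apply-linear : ∀ A m (k : ℕ → Carrier) (G : ℕ → Series) →
    apply A (ΣS m (λ i → k i ⋆ G i)) ≈ₛ ΣS m (λ i → k i ⋆ apply A (G i))
  apply-linear A m k G = transₛ (apply-ΣS A m _) (ΣS-cong m (λ i → apply-⋆ A (k i) (G i)))

  apply-X^ : ∀ A → Lower A → ∀ k → apply A (X ^ₛ k) ≈ₛ column A k
  apply-X^ A low k n = trans (Σ-cong′ n (λ i → trans (*-cong refl (X^-coefficient k i)) (*-comm _ _)))
                             (sift (k ≤? n))
    where
    sift : Dec (k ≤ n) → Σ≤ n (λ i → δ i k * A n i) ≈ A n k
    sift (yes k≤n) = Σ-δ-in n k (A n) k≤n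
    sift (no k≰n)  = trans (Σ-δ-out n k (A n) (≰⇒> k≰n)) (sym (low n k (≰⇒> k≰n)))

  apply-Id : ∀ u → apply Id u ≈ₛ u
  apply-Id u n = trans (Σ-cong′ n (λ k → *-cong (reflexive (δ-sym n k)) refl)) (Σ-δ-in n n u ≤-refl)

  -- Only the lower triangular part of B enters: terms with m < k vanish.
  apply-♯ : ∀ A B → Lower B → ∀ u → apply (A ♯ B) u ≈ₛ apply A (apply B u)
  apply-♯ A B low u n = begin
    Σ≤ n (λ k → Σ≤ n (λ m → A n m * B m k) * u k)
      ≈⟨ Σ-cong′ n (λ k → Σ-*ʳ n (u k) _) ⟩
    Σ≤ n (λ k → Σ≤ n (λ m → (A n m * B m k) * u k))
      ≈⟨ Σ-swap n n _ ⟩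
    Σ≤ n (λ m → Σ≤ n (λ k → (A n m * B m k) * u k))
      ≈⟨ Σ-cong′ n (λ m → trans (Σ-cong′ n (λ k → *-assoc _ _ _)) (sym (Σ-*ˡ n (A n m) _))) ⟩
    Σ≤ n (λ m → A n m * Σ≤ n (λ k → B m k * u k))
      ≈⟨ Σ-cong n (λ m m≤n → *-cong refl (Σ-extend _ m≤n (λ k m<k →
           trans (*-cong (low m k m<k) refl) (zeroˡ _)))) ⟩
    Σ≤ n (λ m → A n m * Σ≤ m (λ k → B m k * u k)) ∎
    where open ≈-Reasoning

  ♯-cong : ∀ {A A′ B B′} → A ≈P A′ → B ≈P B′ → (A ♯ B) ≈P (A′ ♯ B′)
  ♯-cong A≈A′ B≈B′ n j = Σ-cong′ n (λ k → *-cong (A≈A′ n k) (B≈B′ k j))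

  ♯-assoc : ∀ A B C → Lower B → ((A ♯ B) ♯ C) ≈P (A ♯ (B ♯ C))
  ♯-assoc A B C low n j = apply-♯ A B low (column C j) n

  Id-♯ : ∀ A → (Id ♯ A) ≈P A
  Id-♯ A n j = apply-Id (column A j) n

  ♯-Id : ∀ A → Lower A → (A ♯ Id) ≈P A
  ♯-Id A low n j = trans (Σ-cong′ n (λ k → *-cong refl (sym (X^-coefficient j k))))
                         (apply-X^ A low j n)

  Lower-Id : Lower Id
  Lower-Id n k n<k = reflexive (δ-off n k (<⇒≢ n<k))

  Lower-♯ : ∀ A B → Lower B → Lower (A ♯ B)
  Lower-♯ A B low n j n<j =
    Σ-zero n _ (λ k k≤n → trans (*-cong refl (low k j (≤-<-trans k≤n n<j))) (zeroʳ _))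

  ♯-diagonal : ∀ A B → Lower B → ∀ k → (A ♯ B) k k ≈ A k k * B k k
  ♯-diagonal A B low k =
    Σ-only-last k _ (λ i i<k → trans (*-cong refl (low i k i<k)) (zeroʳ _))

  -- Course-of-values recursion: cov s n = s n (cov s), where s n may only
  -- inspect its argument below n.  table s n m stores cov s m for m < n.

  Step : Set c
  Step = (n : ℕ) → (ℕ → Carrier) → Carrier

  table : Step → ℕ → ℕ → Carrier
  table s zero    m = 0#
  table s (suc n) m with m ≟ n
  ... | yes _ = s n (table s n)
  ... | no  _ = table s n m

  cov : Step → ℕ → Carrier
  cov s n = s n (table s n)

  table-cov : ∀ s n m → m < n → table s n m ≡ cov s m
  table-cov s (suc n) m m<1+n with m ≟ n
  ... | yes ≡.refl = ≡.refl
  ... | no  m≢n    = table-cov s n m (≤∧≢⇒< (≤-pred m<1+n) m≢n)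

  cov-unfold : ∀ s → (∀ n f g → (∀ k → k < n → f k ≈ g k) → s n f ≈ s n g) →
               ∀ n → cov s n ≈ s n (cov s)
  cov-unfold s local n = local n (table s n) (cov s) (λ k k<n → reflexive (table-cov s n k k<n))

  -- Forward substitution: if A has nonzero diagonal, apply A u = y is solved by
  -- u_n = (y_n - Σ_{k<n} A_{n,k} u_k) / A_{n,n}.

  substStep : PolySeq → Series → Step
  substStep A y n u = inv (A n n) * (y n + - Σ< n (λ k → A n k * u k))

  substitute : PolySeq → Series → Series
  substitute A y = cov (substStep A y)

  substitute-unfold : ∀ A y n → substitute A y n ≈ substStep A y n (substitute A y)
  substitute-unfold A y = cov-unfold (substStep A y) (λ n f g f≈g →
    *-cong refl (+-cong refl (-‿cong (Σ<-cong n (λ k k<n → *-cong refl (f≈g k k<n))))))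

  substitute-solves : ∀ A y → (∀ n → ¬ (A n n ≈ 0#)) → apply A (substitute A y) ≈ₛ y
  substitute-solves A y diag n = begin
    Σ≤ n (λ k → A n k * u k)                 ≈⟨ Σ-last n _ ⟩
    S + A n n * u n                           ≈⟨ +-cong refl (*-cong refl (substitute-unfold A y n)) ⟩
    S + A n n * (inv (A n n) * (y n + - S))  ≈⟨ +-cong refl (sym (*-assoc _ _ _)) ⟩
    S + (A n n * inv (A n n)) * (y n + - S)  ≈⟨ +-cong refl (*-cong (inv-r _ (diag n)) refl) ⟩
    S + 1# * (y n + - S)                     ≈⟨ +-cong refl (*-identityˡ _) ⟩
    S + (y n + - S)                          ≈⟨ +-cancel-neg S (y n) ⟩
    y n                                       ∎
    where
    open ≈-Reasoning
    u = substitute A y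
    S = Σ< n (λ k → A n k * u k)

  substitute-vanishes : ∀ A y j → (∀ m → m < j → y m ≈ 0#) →
                        ∀ m → m < j → substitute A y m ≈ 0#
  substitute-vanishes A y j y≈0 = <-rec (λ m → m < j → substitute A y m ≈ 0#) step
    where
    open ≈-Reasoning
    step : ∀ m → (∀ {k} → k < m → k < j → substitute A y k ≈ 0#) → m < j → substitute A y m ≈ 0#
    step m below m<j = begin
      substitute A y m                                     ≈⟨ substitute-unfold A y m ⟩
      inv (A m m) * (y m + - Σ< m (λ k → A m k * substitute A y k))
        ≈⟨ *-cong refl (+-cong (y≈0 m m<j) (-‿cong (Σ<-zero m _ (λ k k<m →
             trans (*-cong refl (below k<m (<-trans k<m m<j))) (zeroʳ _))))) ⟩
      inv (A m m) * (0# + - 0#)                             ≈⟨ *-cong refl (-‿inverseʳ 0#) ⟩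
      inv (A m m) * 0#                                      ≈⟨ zeroʳ _ ⟩
      0#                                                    ∎

  -- A lower triangular right inverse of any array with nonzero diagonal,
  -- obtained by solving for the columns of Id.

  rightInverse : PolySeq → PolySeq
  rightInverse A n j = substitute A (column Id j) n

  rightInverse-inverts : ∀ A → (∀ n → ¬ (A n n ≈ 0#)) → (A ♯ rightInverse A) ≈P Id
  rightInverse-inverts A diag n j = substitute-solves A (column Id j) diag n

  rightInverse-lower : ∀ A → Lower (rightInverse A)
  rightInverse-lower A n j n<j =
    substitute-vanishes A (column Id j) j (λ m m<j → Lower-Id m j m<j) n n<j

  rightInverse-diagonal : ∀ A → (∀ n → ¬ (A n n ≈ 0#)) → ∀ n → ¬ (rightInverse A n n ≈ 0#)
  rightInverse-diagonal A diag n B≈0 = 0≉1 (begin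
    0#                           ≈⟨ sym (zeroʳ (A n n)) ⟩
    A n n * 0#                   ≈⟨ *-cong refl (sym B≈0) ⟩
    A n n * rightInverse A n n   ≈⟨ sym (♯-diagonal A _ (rightInverse-lower A) n) ⟩
    (A ♯ rightInverse A) n n     ≈⟨ rightInverse-inverts A diag n n ⟩
    δ n n                        ≈⟨ reflexive (δ-diag n) ⟩
    1#                           ∎)
    where open ≈-Reasoning

  -- A series with nonzero constant term is invertible: solve the Toeplitz
  -- system Σ_k a_{n-k} b_k = [n = 0].

  toeplitz : Series → PolySeq
  toeplitz a n k = a (n ∸ k)

  invₛ : Series → Series
  invₛ a = substitute (toeplitz a) oneₛ

  invₛ-inverts : ∀ a → ¬ (a 0 ≈ 0#) → (a ·ₛ invₛ a) ≈ₛ oneₛ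
  invₛ-inverts a a0≉0 n =
    trans (·-comm a (invₛ a) n)
          (trans (Σ-cong′ n (λ k → *-comm _ _)) (substitute-solves (toeplitz a) oneₛ diag n))
    where
    diag : ∀ n → ¬ (a (n ∸ n) ≈ 0#)
    diag n rewrite n∸n≡0 n = a0≉0

  invₛ-constant-nonzero : ∀ a → ¬ (a 0 ≈ 0#) → ¬ (invₛ a 0 ≈ 0#)
  invₛ-constant-nonzero a a0≉0 =
    unit-nonzero (trans (*-comm _ _) (invₛ-inverts a a0≉0 0))

  ·-cancelʳ : ∀ a b d → ¬ (d 0 ≈ 0#) → (a ·ₛ d) ≈ₛ (b ·ₛ d) → a ≈ₛ b
  ·-cancelʳ a b d d0≉0 ad≈bd = begin
    a                        ≈⟨ symₛ (·-identityʳ a) ⟩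
    a ·ₛ oneₛ                ≈⟨ ·-cong (reflₛ {a}) (symₛ (invₛ-inverts d d0≉0)) ⟩
    a ·ₛ (d ·ₛ invₛ d)       ≈⟨ symₛ (·-assoc a d (invₛ d)) ⟩
    (a ·ₛ d) ·ₛ invₛ d       ≈⟨ ·-cong ad≈bd (reflₛ {invₛ d}) ⟩
    (b ·ₛ d) ·ₛ invₛ d       ≈⟨ ·-assoc b d (invₛ d) ⟩
    b ·ₛ (d ·ₛ invₛ d)       ≈⟨ ·-cong (reflₛ {b}) (invₛ-inverts d d0≉0) ⟩
    b ·ₛ oneₛ                ≈⟨ ·-identityʳ b ⟩
    b                        ∎
    where open SeriesReasoning

  -- A Riordan array (d, x s) acts on series by
  -- u ↦ d · u(x s); we never form the composition u(x s) but record its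
  -- consequence A(u w) · A(1) = A(u) · A(w), noting A(1) = column A 0 = d.

  Multiplicative : PolySeq → Set (c ⊔ ℓ)
  Multiplicative A = ∀ u w → (apply A (u ·ₛ w) ·ₛ column A 0) ≈ₛ (apply A u ·ₛ apply A w)

  IsRiordan : PolySeq → Set (c ⊔ ℓ)
  IsRiordan A = Lower A × (∀ k → ¬ (A k k ≈ 0#)) × Multiplicative A

  HasColumns : PolySeq → Series → Series → Set ℓ
  HasColumns A d s = ∀ k → column A k ≈ₛ shiftBy k (d ·ₛ (s ^ₛ k))

  -- Both sides of Multiplicative are bilinear and the coefficient of x^n only
  -- depends on u, w up to degree n, so it suffices to check monomials.
  multiplicative-from-monomials : ∀ A →
    (∀ i j → (apply A ((X ^ₛ i) ·ₛ (X ^ₛ j)) ·ₛ column A 0) ≈ₛ (apply A (X ^ₛ i) ·ₛ apply A (X ^ₛ j))) →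
    Multiplicative A
  multiplicative-from-monomials A monomial u w n =
    Agree-trans left (Agree-sym right) n ≤-refl
    where
    d : Series
    d = column A 0
    uw : ℕ → ℕ → Carrier
    uw i j = u i * w j
    expanded : Series
    expanded = ΣS n (λ i → ΣS n (λ j → uw i j ⋆ (apply A (X ^ₛ i) ·ₛ apply A (X ^ₛ j))))
    image-of-product : Agree n (apply A (u ·ₛ w))
                               (ΣS n (λ i → ΣS n (λ j → uw i j ⋆ apply A ((X ^ₛ i) ·ₛ (X ^ₛ j)))))
    image-of-product = Agree-trans
      (apply-Agree A (Agree-trans (·-Agree (truncation n u) (truncation n w))
                                  (≈⇒Agree (ΣS-·-ΣS n u w (X ^ₛ_) (X ^ₛ_)))))
      (≈⇒Agree (transₛ (apply-ΣS A n _) (ΣS-cong n (λ i → apply-linear A n (uw i) _))))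
    left : Agree n (apply A (u ·ₛ w) ·ₛ column A 0) expanded
    left = Agree-trans (·-Agree image-of-product (≈⇒Agree (reflₛ {d})))
      (≈⇒Agree (transₛ (ΣS-· n _ d) (ΣS-cong n (λ i → transₛ (ΣS-· n _ d) (ΣS-cong n (λ j →
        transₛ (⋆-· (uw i j) (apply A ((X ^ₛ i) ·ₛ (X ^ₛ j))) d) (⋆-cong refl (monomial i j))))))))
    right : Agree n (apply A u ·ₛ apply A w) expanded
    right = Agree-trans
      (·-Agree (apply-Agree A (truncation n u)) (apply-Agree A (truncation n w)))
      (≈⇒Agree (transₛ (·-cong (apply-linear A n u _) (apply-linear A n w _))
                       (ΣS-·-ΣS n u w (λ i → apply A (X ^ₛ i)) (λ j → apply A (X ^ₛ j)))))

  -- Columns x^k d s^k vanish above the diagonal, have diagonal d(0) s(0)^k,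
  -- and multiply like monomials.
  hasColumns⇒isRiordan : ∀ {A d s} → ¬ (d 0 ≈ 0#) → ¬ (s 0 ≈ 0#) → HasColumns A d s → IsRiordan A
  hasColumns⇒isRiordan {A} {d} {s} d0≉0 s0≉0 cols = lower , diagonal , multiplicative
    where
    lower : Lower A
    lower n k n<k = trans (cols k n) (reflexive (shiftBy-below k _ n n<k))
    diagonal : ∀ k → ¬ (A k k ≈ 0#)
    diagonal k Akk≈0 = *-nonzero d0≉0 (^-constant-nonzero s k s0≉0)
      (trans (reflexive (≡.sym (shiftBy-at k (d ·ₛ (s ^ₛ k))))) (trans (sym (cols k k)) Akk≈0))
    image : ∀ k → apply A (X ^ₛ k) ≈ₛ ((X ^ₛ k) ·ₛ (d ·ₛ (s ^ₛ k)))
    image k = transₛ (apply-X^ A lower k) (transₛ (cols k) (shiftBy≈X^· k _))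
    multiplicative : Multiplicative A
    multiplicative = multiplicative-from-monomials A λ i j → begin
      apply A ((X ^ₛ i) ·ₛ (X ^ₛ j)) ·ₛ column A 0
        ≈⟨ ·-cong (transₛ (apply-cong reflP (symₛ (^-+ X i j))) (image (i +ℕ j)))
                  (transₛ (cols 0) (·-identityʳ d)) ⟩
      ((X ^ₛ (i +ℕ j)) ·ₛ (d ·ₛ (s ^ₛ (i +ℕ j)))) ·ₛ d
        ≈⟨ ·-cong (·-cong (^-+ X i j) (·-cong (reflₛ {d}) (^-+ s i j))) (reflₛ {d}) ⟩
      (((X ^ₛ i) ·ₛ (X ^ₛ j)) ·ₛ (d ·ₛ ((s ^ₛ i) ·ₛ (s ^ₛ j)))) ·ₛ d
        ≈⟨ solve 5 (λ xi xj d si sj → ((xi ⊕ xj) ⊕ (d ⊕ (si ⊕ sj))) ⊕ d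
                                       ⊜ (xi ⊕ (d ⊕ si)) ⊕ (xj ⊕ (d ⊕ sj)))
                   reflₛ (X ^ₛ i) (X ^ₛ j) d (s ^ₛ i) (s ^ₛ j) ⟩
      ((X ^ₛ i) ·ₛ (d ·ₛ (s ^ₛ i))) ·ₛ ((X ^ₛ j) ·ₛ (d ·ₛ (s ^ₛ j)))
        ≈⟨ symₛ (·-cong (image i) (image j)) ⟩
      apply A (X ^ₛ i) ·ₛ apply A (X ^ₛ j) ∎
      where
      open SeriesReasoning
      open ·-Solver

  -- Conversely a Riordan-like array has columns x^k d s^k, where d = column A 0
  -- and x s · d = column A 1 (which vanishes at 0 since A is lower triangular).
  isRiordan⇒hasColumns : ∀ {A} → IsRiordan A →
    Σ Series λ d → Σ Series λ s → ¬ (d 0 ≈ 0#) × ¬ (s 0 ≈ 0#) × HasColumns A d s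
  isRiordan⇒hasColumns {A} (lower , diagonal , multiplicative) =
    d , s , diagonal 0 , s0≉0 , cols
    where
    d σ s : Series
    d = column A 0
    σ n = A (suc n) 1
    s = σ ·ₛ invₛ d
    s0≉0 : ¬ (s 0 ≈ 0#)
    s0≉0 = *-nonzero (diagonal 1) (invₛ-constant-nonzero d (diagonal 0))
    σ≈s·d : σ ≈ₛ (s ·ₛ d)
    σ≈s·d = symₛ (transₛ (·-assoc σ (invₛ d) d) (transₛ (·-cong (reflₛ {σ}) (·-comm (invₛ d) d))
              (transₛ (·-cong (reflₛ {σ}) (invₛ-inverts d (diagonal 0))) (·-identityʳ σ))))
    column₁ : apply A X ≈ₛ (X ·ₛ (s ·ₛ d))
    column₁ = transₛ (apply-cong reflP (symₛ (·-identityʳ X))) (transₛ (apply-X^ A lower 1)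
      (transₛ shifted (transₛ (symₛ (X-· σ)) (·-cong (reflₛ {X}) σ≈s·d))))
      where
      shifted : column A 1 ≈ₛ shift σ
      shifted zero    = lower 0 1 (s≤s z≤n)
      shifted (suc n) = refl
    cols : HasColumns A d s
    cols zero    = symₛ (·-identityʳ d)
    cols (suc k) = ·-cancelʳ _ _ d (diagonal 0) (begin
      column A (suc k) ·ₛ d
        ≈⟨ ·-cong (symₛ (apply-X^ A lower (suc k))) (reflₛ {d}) ⟩
      apply A (X ·ₛ (X ^ₛ k)) ·ₛ column A 0
        ≈⟨ multiplicative X (X ^ₛ k) ⟩
      apply A X ·ₛ apply A (X ^ₛ k)
        ≈⟨ ·-cong column₁ (transₛ (apply-X^ A lower k) (transₛ (cols k) (shiftBy≈X^· k _))) ⟩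
      (X ·ₛ (s ·ₛ d)) ·ₛ ((X ^ₛ k) ·ₛ (d ·ₛ (s ^ₛ k)))
        ≈⟨ solve 5 (λ x s d p q → (x ⊕ (s ⊕ d)) ⊕ (p ⊕ (d ⊕ q)) ⊜ ((x ⊕ p) ⊕ (d ⊕ (s ⊕ q))) ⊕ d)
             reflₛ X s d (X ^ₛ k) (s ^ₛ k) ⟩
      ((X ^ₛ suc k) ·ₛ (d ·ₛ (s ^ₛ suc k))) ·ₛ d
        ≈⟨ ·-cong (symₛ (shiftBy≈X^· (suc k) _)) (reflₛ {d}) ⟩
      shiftBy (suc k) (d ·ₛ (s ^ₛ suc k)) ·ₛ d ∎)
      where
      open SeriesReasoning
      open ·-Solver

  -- Passing between T(f | g) and the column description: with s = 1/g and
  -- d = f/g one has (x^k d s^k) g^{k+1} = x^k d g = x^k f.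

  twist : ∀ {s g} → (s ·ₛ g) ≈ₛ oneₛ → ∀ d k →
          (((X ^ₛ k) ·ₛ (d ·ₛ (s ^ₛ k))) ·ₛ (g ^ₛ suc k)) ≈ₛ ((X ^ₛ k) ·ₛ (d ·ₛ g))
  twist {s} {g} s·g≈1 d k = begin
    ((X ^ₛ k) ·ₛ (d ·ₛ (s ^ₛ k))) ·ₛ (g ·ₛ (g ^ₛ k))
      ≈⟨ solve 5 (λ x d s g h → (x ⊕ (d ⊕ s)) ⊕ (g ⊕ h) ⊜ x ⊕ ((d ⊕ g) ⊕ (s ⊕ h)))
           reflₛ (X ^ₛ k) d (s ^ₛ k) g (g ^ₛ k) ⟩
    (X ^ₛ k) ·ₛ ((d ·ₛ g) ·ₛ ((s ^ₛ k) ·ₛ (g ^ₛ k)))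
      ≈⟨ ·-cong (reflₛ {X ^ₛ k}) (·-cong (reflₛ {d ·ₛ g})
           (transₛ (symₛ (^-· s g k)) (transₛ (^-cong k s·g≈1) (one-^ k)))) ⟩
    (X ^ₛ k) ·ₛ ((d ·ₛ g) ·ₛ oneₛ)
      ≈⟨ ·-cong (reflₛ {X ^ₛ k}) (·-identityʳ (d ·ₛ g)) ⟩
    (X ^ₛ k) ·ₛ (d ·ₛ g) ∎
    where
    open SeriesReasoning
    open ·-Solver

  hasColumns⇒IsT : ∀ {A d s g} → (s ·ₛ g) ≈ₛ oneₛ → HasColumns A d s → IsT (d ·ₛ g) g A
  hasColumns⇒IsT {A} {d} {s} {g} s·g≈1 cols k =
    transₛ (·-cong (transₛ (cols k) (shiftBy≈X^· k _)) (reflₛ {g ^ₛ suc k}))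
           (transₛ (twist s·g≈1 d k) (symₛ (shiftBy≈X^· k (d ·ₛ g))))

  IsT⇒hasColumns : ∀ {A f g} → ¬ (g 0 ≈ 0#) → IsT f g A → HasColumns A (f ·ₛ invₛ g) (invₛ g)
  IsT⇒hasColumns {A} {f} {g} g0≉0 isT k =
    ·-cancelʳ _ _ (g ^ₛ suc k) (^-constant-nonzero g (suc k) g0≉0) (begin
      column A k ·ₛ (g ^ₛ suc k)
        ≈⟨ transₛ (isT k) (shiftBy≈X^· k f) ⟩
      (X ^ₛ k) ·ₛ f
        ≈⟨ ·-cong (reflₛ {X ^ₛ k}) f≈d·g ⟩
      (X ^ₛ k) ·ₛ (d ·ₛ g)
        ≈⟨ symₛ (twist gi·g≈1 d k) ⟩
      ((X ^ₛ k) ·ₛ (d ·ₛ (gi ^ₛ k))) ·ₛ (g ^ₛ suc k)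
        ≈⟨ ·-cong (symₛ (shiftBy≈X^· k _)) (reflₛ {g ^ₛ suc k}) ⟩
      shiftBy k (d ·ₛ (gi ^ₛ k)) ·ₛ (g ^ₛ suc k) ∎)
    where
    open SeriesReasoning
    gi d : Series
    gi = invₛ g
    d = f ·ₛ gi
    gi·g≈1 : (gi ·ₛ g) ≈ₛ oneₛ
    gi·g≈1 = transₛ (·-comm gi g) (invₛ-inverts g g0≉0)
    f≈d·g : f ≈ₛ (d ·ₛ g)
    f≈d·g = symₛ (transₛ (·-assoc f gi g) (transₛ (·-cong (reflₛ {f}) gi·g≈1) (·-identityʳ f)))

  ℛ⇒isRiordan : ∀ {A} → Inℛ A → IsRiordan A
  ℛ⇒isRiordan (f , g , f0≉0 , g0≉0 , isT) =
    hasColumns⇒isRiordan (*-nonzero f0≉0 gi0≉0) gi0≉0 (IsT⇒hasColumns g0≉0 isT)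
    where
    gi0≉0 : ¬ (invₛ g 0 ≈ 0#)
    gi0≉0 = invₛ-constant-nonzero g g0≉0

  isRiordan⇒ℛ : ∀ {A} → IsRiordan A → Inℛ A
  isRiordan⇒ℛ riordan with isRiordan⇒hasColumns riordan
  ... | d , s , d0≉0 , s0≉0 , cols =
    d ·ₛ g , g , *-nonzero d0≉0 g0≉0 , g0≉0 , hasColumns⇒IsT (invₛ-inverts s s0≉0) cols
    where
    g : Series
    g = invₛ s
    g0≉0 : ¬ (g 0 ≈ 0#)
    g0≉0 = invₛ-constant-nonzero s s0≉0

  isRiordan-♯ : ∀ {A B} → IsRiordan A → IsRiordan B → IsRiordan (A ♯ B)
  isRiordan-♯ {A} {B} (lowerA , diagA , multA) (lowerB , diagB , multB) =
    Lower-♯ A B lowerB , diagonal , multiplicative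
    where
    diagonal : ∀ k → ¬ ((A ♯ B) k k ≈ 0#)
    diagonal k AB≈0 = *-nonzero (diagA k) (diagB k) (trans (sym (♯-diagonal A B lowerB k)) AB≈0)
    AB = apply-♯ A B lowerB
    multiplicative : Multiplicative (A ♯ B)
    multiplicative u w = begin
      apply (A ♯ B) (u ·ₛ w) ·ₛ apply A (column B 0)
        ≈⟨ ·-cong (AB (u ·ₛ w)) (reflₛ {apply A (column B 0)}) ⟩
      apply A (apply B (u ·ₛ w)) ·ₛ apply A (column B 0)
        ≈⟨ symₛ (multA (apply B (u ·ₛ w)) (column B 0)) ⟩
      apply A (apply B (u ·ₛ w) ·ₛ column B 0) ·ₛ column A 0
        ≈⟨ ·-cong (apply-cong reflP (multB u w)) (reflₛ {column A 0}) ⟩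
      apply A (apply B u ·ₛ apply B w) ·ₛ column A 0
        ≈⟨ multA (apply B u) (apply B w) ⟩
      apply A (apply B u) ·ₛ apply A (apply B w)
        ≈⟨ ·-cong (symₛ (AB u)) (symₛ (AB w)) ⟩
      apply (A ♯ B) u ·ₛ apply (A ♯ B) w ∎
      where open SeriesReasoning

  isRiordan-Id : IsRiordan Id
  isRiordan-Id = Lower-Id , (λ k δkk≈0 → 1≉0 (trans (sym (reflexive (δ-diag k))) δkk≈0)) ,
    λ u w → transₛ (·-cong (apply-Id (u ·ₛ w)) (λ n → reflexive (≡.sym (oneₛ≡δ n))))
            (transₛ (·-identityʳ (u ·ₛ w)) (symₛ (·-cong (apply-Id u) (apply-Id w))))

  -- A right inverse B of A which itself has a right inverse C is two-sided,
  -- since then A = A ♯ (B ♯ C) = (A ♯ B) ♯ C = C.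
  two-sided : ∀ A B C → Lower A → Lower B → (A ♯ B) ≈P Id → (B ♯ C) ≈P Id → (B ♯ A) ≈P Id
  two-sided A B C lowerA lowerB AB≈Id BC≈Id = transP (♯-cong (reflP {B}) A≈C) BC≈Id
    where
    A≈C : A ≈P C
    A≈C = transP (symP (♯-Id A lowerA)) (transP (♯-cong (reflP {A}) (symP BC≈Id))
            (transP (symP (♯-assoc A B C lowerB)) (transP (♯-cong AB≈Id (reflP {C})) (Id-♯ C))))

  -- The inverse of a multiplicative array is multiplicative: apply A is
  -- injective and maps both sides of the identity for B to the same series.
  multiplicative-inverse : ∀ {A B} → Lower A → Lower B → ¬ (A 0 0 ≈ 0#) → Multiplicative A →
    (A ♯ B) ≈P Id → (B ♯ A) ≈P Id → Multiplicative B
  multiplicative-inverse {A} {B} lowerA lowerB A00≉0 multA AB≈Id BA≈Id u w =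
    transₛ (symₛ (B-A v)) (transₛ (apply-cong reflP A-equal) (B-A v′))
    where
    open SeriesReasoning
    A-B : ∀ v → apply A (apply B v) ≈ₛ v
    A-B v = transₛ (symₛ (apply-♯ A B lowerB v)) (transₛ (apply-cong AB≈Id reflₛ) (apply-Id v))
    B-A : ∀ v → apply B (apply A v) ≈ₛ v
    B-A v = transₛ (symₛ (apply-♯ B A lowerA v)) (transₛ (apply-cong BA≈Id reflₛ) (apply-Id v))
    v v′ : Series
    v  = apply B (u ·ₛ w) ·ₛ column B 0
    v′ = apply B u ·ₛ apply B w
    A-B₀ : apply A (column B 0) ≈ₛ oneₛ
    A-B₀ n = trans (AB≈Id n 0) (reflexive (≡.sym (oneₛ≡δ n)))
    A-equal : apply A v ≈ₛ apply A v′
    A-equal = ·-cancelʳ _ _ (column A 0) A00≉0 (begin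
      apply A v ·ₛ column A 0                           ≈⟨ multA (apply B (u ·ₛ w)) (column B 0) ⟩
      apply A (apply B (u ·ₛ w)) ·ₛ apply A (column B 0) ≈⟨ ·-cong (A-B (u ·ₛ w)) A-B₀ ⟩
      (u ·ₛ w) ·ₛ oneₛ                                  ≈⟨ ·-identityʳ (u ·ₛ w) ⟩
      u ·ₛ w                                            ≈⟨ symₛ (·-cong (A-B u) (A-B w)) ⟩
      apply A (apply B u) ·ₛ apply A (apply B w)        ≈⟨ symₛ (multA (apply B u) (apply B w)) ⟩
      apply A v′ ·ₛ column A 0                          ∎)

  isRiordan-inverse : ∀ {A} → IsRiordan A →
    Σ PolySeq λ B → IsRiordan B × ((A ♯ B) ≈P Id) × ((B ♯ A) ≈P Id)
  isRiordan-inverse {A} (lowerA , diagA , multA) =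
    B , (lowerB , diagB , multiplicative-inverse lowerA lowerB (diagA 0) multA AB≈Id BA≈Id) ,
    AB≈Id , BA≈Id
    where
    B : PolySeq
    B = rightInverse A
    lowerB : Lower B
    lowerB = rightInverse-lower A
    diagB : ∀ k → ¬ (B k k ≈ 0#)
    diagB = rightInverse-diagonal A diagA
    AB≈Id : (A ♯ B) ≈P Id
    AB≈Id = rightInverse-inverts A diagA
    BA≈Id : (B ♯ A) ≈P Id
    BA≈Id = two-sided A B (rightInverse B) lowerA lowerB AB≈Id (rightInverse-inverts B diagB)

  ℛ-cong : ∀ {A A′} → Inℛ A → A ≈P A′ → Inℛ A′
  ℛ-cong (f , g , f0≉0 , g0≉0 , isT) A≈A′ =
    f , g , f0≉0 , g0≉0 , λ k → transₛ (·-cong (λ n → sym (A≈A′ n k)) (reflₛ {g ^ₛ suc k})) (isT k)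

  ℛ-lower : ∀ {A} → Inℛ A → Lower A
  ℛ-lower A∈ℛ = proj₁ (ℛ⇒isRiordan A∈ℛ)

  ℛ-♯ : ∀ {A B} → Inℛ A → Inℛ B → Inℛ (A ♯ B)
  ℛ-♯ A∈ℛ B∈ℛ = isRiordan⇒ℛ (isRiordan-♯ (ℛ⇒isRiordan A∈ℛ) (ℛ⇒isRiordan B∈ℛ))

  ℛ-Id : Inℛ Id
  ℛ-Id = isRiordan⇒ℛ isRiordan-Id

  ℛ-inverse : ∀ {A} → Inℛ A → Σ PolySeq λ B → Inℛ B × ((A ♯ B) ≈P Id) × ((B ♯ A) ≈P Id)
  ℛ-inverse A∈ℛ =
    let (B , B-riordan , inverses) = isRiordan-inverse (ℛ⇒isRiordan A∈ℛ)
    in B , isRiordan⇒ℛ B-riordan , inverses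

  module HadamardTransport (h : Series) (h≉0 : ∀ n → ¬ (h n ≈ 0#)) where

    H⁻¹-H : ∀ P → Hh⁻¹ h (Hh h P) ≈P P
    H⁻¹-H P n k = trans (*-assoc _ _ _) (trans (*-cong refl (inv-r (h k) (h≉0 k))) (*-identityʳ _))

    H-H⁻¹ : ∀ S → Hh h (Hh⁻¹ h S) ≈P S
    H-H⁻¹ S n k = trans (*-assoc _ _ _) (trans (*-cong refl (inv-l (h k) (h≉0 k))) (*-identityʳ _))

    H-cong : ∀ {P Q} → P ≈P Q → Hh h P ≈P Hh h Q
    H-cong P≈Q n k = *-cong (P≈Q n k) refl

    H⁻¹-cong : ∀ {S T} → S ≈P T → Hh⁻¹ h S ≈P Hh⁻¹ h T
    H⁻¹-cong S≈T n k = *-cong (S≈T n k) refl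

    ℛh⇒ℛ : ∀ S → Inℛh h S → Inℛ (Hh⁻¹ h S)
    ℛh⇒ℛ S (P , P∈ℛ , HP≈S) = ℛ-cong P∈ℛ (transP (symP (H⁻¹-H P)) (H⁻¹-cong HP≈S))

    ♯h-group : IsGroupOn (Inℛh h) ♯[ h ]
    ♯h-group = record
      { ∙-cong    = λ S≈S′ T≈T′ → H-cong (♯-cong (H⁻¹-cong S≈S′) (H⁻¹-cong T≈T′))
      ; closed    = λ {S} {T} S∈ T∈ → Hh⁻¹ h S ♯ Hh⁻¹ h T , ℛ-♯ (ℛh⇒ℛ S S∈) (ℛh⇒ℛ T T∈) , reflP
      ; assoc     = λ {S} {T} {U} _ T∈ _ → H-cong (transP (♯-cong (H⁻¹-H _) reflP)
                      (transP (♯-assoc _ _ _ (ℛ-lower (ℛh⇒ℛ T T∈))) (♯-cong reflP (symP (H⁻¹-H _)))))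
      ; e         = Hh h Id
      ; e∈U       = Id , ℛ-Id , reflP
      ; identityˡ = λ {S} _ → transP (H-cong (transP (♯-cong (H⁻¹-H Id) reflP) (Id-♯ _))) (H-H⁻¹ S)
      ; identityʳ = λ {S} S∈ → transP (H-cong (transP (♯-cong reflP (H⁻¹-H Id))
                      (♯-Id _ (ℛ-lower (ℛh⇒ℛ S S∈))))) (H-H⁻¹ S)
      ; inverse   = inverse
      }
      where
      inverse : ∀ {S} → Inℛh h S →
        Σ PolySeq λ T → Inℛh h T × (♯[ h ] S T ≈P Hh h Id) × (♯[ h ] T S ≈P Hh h Id)
      inverse {S} S∈ =
        let (B , B∈ℛ , AB≈Id , BA≈Id) = ℛ-inverse (ℛh⇒ℛ S S∈)
        in Hh h B , (B , B∈ℛ , reflP) ,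
           H-cong (transP (♯-cong reflP (H⁻¹-H B)) AB≈Id) ,
           H-cong (transP (♯-cong (H⁻¹-H B) reflP) BA≈Id)

    ♯h-entry : ∀ S T n j → ♯[ h ] S T n j ≈ Σ≤ n (λ k → (inv (h k) * S n k) * T k j)
    ♯h-entry S T n j = trans (Σ-*ʳ n (h j) _) (Σ-cong′ n (λ k → begin
      ((S n k * inv (h k)) * (T k j * inv (h j))) * h j
        ≈⟨ solve 5 (λ s ik t ij hj → ((s ⊕ ik) ⊕ (t ⊕ ij)) ⊕ hj ⊜ ((ik ⊕ s) ⊕ t) ⊕ (ij ⊕ hj))
             refl (S n k) (inv (h k)) (T k j) (inv (h j)) (h j) ⟩
      ((inv (h k) * S n k) * T k j) * (inv (h j) * h j)
        ≈⟨ *-cong refl (inv-l (h j) (h≉0 j)) ⟩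
      ((inv (h k) * S n k) * T k j) * 1#
        ≈⟨ *-identityʳ _ ⟩
      (inv (h k) * S n k) * T k j ∎))
      where
      open ≈-Reasoning
      open CMSolver *-commutativeMonoid using (solve; _⊕_; _⊜_)

    -- For t ∈ ℛ_h the terms with k < j vanish, leaving Σ_{k=j}^{n}.
    ♯h-coefficients : ∀ S T → Inℛh h T → ∀ n j → j ≤ n →
      ♯[ h ] S T n j ≈ ΣFromTo j n (λ k → (inv (h k) * S n k) * T k j)
    ♯h-coefficients S T T∈ n j j≤n = trans (♯h-entry S T n j)
      (≡.subst (λ m → Σ≤ m G ≈ ΣFromTo j n G) (m+[n∸m]≡n j≤n) (Σ-skip j (n ∸ j) G vanish))
      where
      G : ℕ → Carrier
      G k = (inv (h k) * S n k) * T k j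
      vanish : ∀ k → k < j → G k ≈ 0#
      vanish k k<j = trans (*-cong refl (trans (sym (H-H⁻¹ T k j))
        (trans (*-cong (ℛ-lower (ℛh⇒ℛ T T∈) k j k<j) refl) (zeroˡ _)))) (zeroʳ _)

mainTheorem11 : ∀ {c ℓ : Level} (F : Field c ℓ) → Riordan.CharZero F →
    (h : ℕ → Field.Carrier F) → (∀ n → ¬ (Field._≈_ F (h n) (Field.0# F))) →
    let open Field F
        open Riordan F
    in
    (∀ P → Inℛ P → Inℛh h (Hh h P))
    × (∀ P Q → Inℛ P → Inℛ Q → Hh h P ≈P Hh h Q → P ≈P Q)
    × (∀ S → Inℛh h S → Σ PolySeq λ P → Inℛ P × (Hh h P ≈P S))
    × (∀ P → Inℛ P → Hh⁻¹ h (Hh h P) ≈P P)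
    × (∀ S → Inℛh h S → Inℛ (Hh⁻¹ h S) × (Hh h (Hh⁻¹ h S) ≈P S))
    × IsGroupOn (Inℛh h) ♯[ h ]
    × (∀ P Q → Inℛ P → Inℛ Q → Hh h (P ♯ Q) ≈P ♯[ h ] (Hh h P) (Hh h Q))
    × (∀ S T → Inℛh h S → Inℛh h T → ∀ n j → j ≤ n →
         ♯[ h ] S T n j ≈ ΣFromTo j n (λ k → (inv (h k) * S n k) * T k j))
mainTheorem11 F _ h h≉0 =
    (λ P P∈ℛ → P , P∈ℛ , reflP)
  , (λ P Q _ _ HP≈HQ → transP (symP (H⁻¹-H P)) (transP (H⁻¹-cong HP≈HQ) (H⁻¹-H Q)))
  , (λ S S∈ → S∈)
  , (λ P _ → H⁻¹-H P)
  , (λ S S∈ → ℛh⇒ℛ S S∈ , H-H⁻¹ S)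
  , ♯h-group
  , (λ P Q _ _ → H-cong (♯-cong (symP (H⁻¹-H P)) (symP (H⁻¹-H Q))))
  , (λ S T _ T∈ → ♯h-coefficients S T T∈)
  where
  open RiordanTheory F
  open HadamardTransport h h≉0
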